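{- Let $G$ be a (not necessarily commutative) preordered group, $\vdash$ a regular entailment relation for $G$, and $V$ the distributive lattice it generates, with order $\leqslant_V$. For $a,b\in V$, let $\leqslant_{a,b}$ be the least preorder on $V$ containing $\leqslant_V$, compatible with the lattice operations and invariant under the left and right actions of $G$, such that $b\leqslant_{a,b}a$. Then for all $u,v\in V$: if $u\leqslant_{a,b}v$ and $u\leqslant_{b,a}v$, then $u\leqslant_V v$.
   Context: $G$ is a group (written multiplicatively) with a preorder $\leqslant$ such that $a\leqslant b$ implies $xay\leqslant xby$. $A,B,A',B'$ denote nonempty finite subsets of $G$; $a$ stands for $\{a\}$, commas denote unions, $xAy=\{xay:a\in A\}$. A regular entailment relation for $G$ is a relation $A\vdash B$ between nonempty finite subsets such that: (R1) $A\vdash B$ if $A\supseteq A'$, $B\supseteq B'$ and $A'\vdash B'$; (R2) $A\vdash B$ if $A,x\vdash B$ and $A\vdash B,x$; (R3) $a\vdash b$ if $a\leqslant b$; (R4) $A\vdash B$ if $xAy\vdash xBy$; (R5) $xa,by\vdash xb,ay$ for all $a,b,x,y\in G$. The distributive lattice $V$ generated by $\vdash$ is presented by generators $a\in G$ and relations $\bigwedge A\leqslant\bigvee B$ for $A\vdash B$; by (R4), left and right multiplication by elements of $G$ extend to lattice automorphisms of $V$ (the left and right actions). -}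

module Defs where

open import Level using (Level; _⊔_) renaming (suc to lsuc)
open import Algebra.Bundles using (Group)
open import Relation.Binary using (Rel; IsPreorder)
open import Data.List using (List; []; _∷_)
open import Data.List.NonEmpty using (List⁺; _∷_; _∷⁺_; [_]; toList) renaming (map to map⁺)
import Data.List.Membership.Setoid as SetoidMembership

record PreorderedGroup (c ℓ₁ ℓ₂ : Level) : Set (lsuc (c ⊔ ℓ₁ ⊔ ℓ₂)) where
  field
    group : Group c ℓ₁
  open Group group public
  field
    _≤_        : Rel Carrier ℓ₂
    isPreorder : IsPreorder _≈_ _≤_
    compat     : ∀ {a b} x y → a ≤ b → ((x ∙ a) ∙ y) ≤ ((x ∙ b) ∙ y)

data Term {c : Level} (X : Set c) : Set c where
  gen : X → Term X
  _∧_ : Term X → Term X → Term X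
  _∨_ : Term X → Term X → Term X

infixr 7 _∧_
infixr 6 _∨_

⋀′ : ∀ {c} {X : Set c} → X → List X → Term X
⋀′ a []      = gen a
⋀′ a (b ∷ l) = gen a ∧ ⋀′ b l

⋁′ : ∀ {c} {X : Set c} → X → List X → Term X
⋁′ a []      = gen a
⋁′ a (b ∷ l) = gen a ∨ ⋁′ b l

⋀ : ∀ {c} {X : Set c} → List⁺ X → Term X
⋀ (a ∷ l) = ⋀′ a l

⋁ : ∀ {c} {X : Set c} → List⁺ X → Term X
⋁ (a ∷ l) = ⋁′ a l

module _ {c ℓ₁ ℓ₂ : Level} (G : PreorderedGroup c ℓ₁ ℓ₂) where
  open PreorderedGroup G
  open SetoidMembership setoid using (_∈_)

  -- nonempty finite subsets of G, represented by nonempty lists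
  -- (set-theoretic meaning via ≈-membership)
  Fin⁺ : Set c
  Fin⁺ = List⁺ Carrier

  _⊇_ : Fin⁺ → Fin⁺ → Set (c ⊔ ℓ₁)
  A ⊇ A' = ∀ {z} → z ∈ toList A' → z ∈ toList A

  _·_·_ : Carrier → Fin⁺ → Carrier → Fin⁺
  x · A · y = map⁺ (λ a → (x ∙ a) ∙ y) A

  ⟨_,_⟩ : Carrier → Carrier → Fin⁺
  ⟨ p , q ⟩ = p ∷ (q ∷ [])

  record IsRegularEntailment {ℓ : Level} (_⊢_ : Fin⁺ → Fin⁺ → Set ℓ)
         : Set (c ⊔ ℓ₁ ⊔ ℓ₂ ⊔ ℓ) where
    field
      R1 : ∀ {A B A′ B′} → A ⊇ A′ → B ⊇ B′ → A′ ⊢ B′ → A ⊢ B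
      R2 : ∀ {A B x} → (x ∷⁺ A) ⊢ B → A ⊢ (x ∷⁺ B) → A ⊢ B
      R3 : ∀ {a b} → a ≤ b → [ a ] ⊢ [ b ]
      R4 : ∀ {A B x y} → (x · A · y) ⊢ (x · B · y) → A ⊢ B
      R5 : ∀ a b x y → ⟨ x ∙ a , b ∙ y ⟩ ⊢ ⟨ x ∙ b , a ∙ y ⟩

  V : Set c
  V = Term Carrier

  _◃_ : Carrier → V → V
  x ◃ gen a   = gen (x ∙ a)
  x ◃ (u ∧ v) = (x ◃ u) ∧ (x ◃ v)
  x ◃ (u ∨ v) = (x ◃ u) ∨ (x ◃ v)

  _▹_ : V → Carrier → V
  gen a   ▹ y = gen (a ∙ y)
  (u ∧ v) ▹ y = (u ▹ y) ∧ (v ▹ y)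
  (u ∨ v) ▹ y = (u ▹ y) ∨ (v ▹ y)

  module _ {ℓ : Level} (_⊢_ : Fin⁺ → Fin⁺ → Set ℓ) where

    -- The order of the distributive lattice V presented by generators a ∈ G
    -- and relations ⋀A ≤ ⋁B for A ⊢ B: the least preorder on terms making
    -- ∧, ∨ a distributive lattice and satisfying these relations.
    data _≤V_ : V → V → Set (c ⊔ ℓ) where
      ≤V-refl  : ∀ {u} → u ≤V u
      ≤V-trans : ∀ {u v w} → u ≤V v → v ≤V w → u ≤V w
      ∧-lowerˡ : ∀ {u v} → (u ∧ v) ≤V u
      ∧-lowerʳ : ∀ {u v} → (u ∧ v) ≤V v
      ∧-great  : ∀ {u v w} → w ≤V u → w ≤V v → w ≤V (u ∧ v)
      ∨-upperˡ : ∀ {u v} → u ≤V (u ∨ v)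
      ∨-upperʳ : ∀ {u v} → v ≤V (u ∨ v)
      ∨-least  : ∀ {u v w} → u ≤V w → v ≤V w → (u ∨ v) ≤V w
      distrib  : ∀ {u v w} → (u ∧ (v ∨ w)) ≤V ((u ∧ v) ∨ (u ∧ w))
      rel      : ∀ {A B} → A ⊢ B → ⋀ A ≤V ⋁ B

    data ≤[_,_] (a b : V) : V → V → Set (c ⊔ ℓ) where
      base   : ∀ {u v} → u ≤V v → ≤[ a , b ] u v
      trans′ : ∀ {u v w} → ≤[ a , b ] u v → ≤[ a , b ] v w → ≤[ a , b ] u w
      ∧-compatˡ : ∀ {u v} w → ≤[ a , b ] u v → ≤[ a , b ] (w ∧ u) (w ∧ v)
      ∧-compatʳ : ∀ {u v} w → ≤[ a , b ] u v → ≤[ a , b ] (u ∧ w) (v ∧ w)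
      ∨-compatˡ : ∀ {u v} w → ≤[ a , b ] u v → ≤[ a , b ] (w ∨ u) (w ∨ v)
      ∨-compatʳ : ∀ {u v} w → ≤[ a , b ] u v → ≤[ a , b ] (u ∨ w) (v ∨ w)
      left   : ∀ {u v} x → ≤[ a , b ] u v → ≤[ a , b ] (x ◃ u) (x ◃ v)
      right  : ∀ {u v} y → ≤[ a , b ] u v → ≤[ a , b ] (u ▹ y) (v ▹ y)
      ax     : ≤[ a , b ] b a

-- A derivation of u ≤_{a,b} v uses the axiom b ≤ a finitely often, each time moved by the two
-- actions, so in V it proves u ≤ v from finitely many hypotheses x b y ≤ x a y. Likewise
-- u ≤_{b,a} v proves u ≤ v from hypotheses x′ a y′ ≤ x′ b y′. Axiom (R5), extended from G to V and
-- applied with s = x⁻¹ x′ and t = y y′⁻¹, gives x b y ∧ x′ a y′ ≤ x a y ∨ x′ b y′; by distributivity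
-- this lets a hypothesis of one family be cut against one of the other, until none is left.
module Submission where

open import Defs
open import Level using (Level; _⊔_)
open import Function using (_∘_)
open import Data.Product using (Σ-syntax; ∃₂; _×_; _,_; proj₁; swap)
import Data.Product as Product
open import Data.List using (List; []; _∷_; _++_; map)
open import Data.List.NonEmpty using (_∷_)
open import Data.List.Relation.Unary.All using (All; []; _∷_)
import Data.List.Relation.Unary.All as All
import Data.List.Relation.Unary.All.Properties as All
import Data.List.Relation.Unary.Any as Any
import Data.List.Relation.Unary.Any.Properties as Any
import Relation.Binary.PropositionalEquality as ≡
open import Relation.Binary using (IsPreorder; Preorder; Setoid)
import Relation.Binary.Reasoning.Preorder as PreorderReasoning
import Relation.Binary.Reasoning.Setoid as SetoidReasoning

module Theory {c ℓ₁ ℓ₂ ℓ : Level} (G : PreorderedGroup c ℓ₁ ℓ₂)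
  (_⊢_ : Fin⁺ G → Fin⁺ G → Set ℓ) (regular : IsRegularEntailment G _⊢_) where

  open PreorderedGroup G
  open IsRegularEntailment regular
  open IsPreorder isPreorder using () renaming (reflexive to ≤-reflexive)
  open import Algebra.Properties.Group group
    using (\\-leftDividesˡ; \\-leftDividesʳ; //-rightDividesˡ; //-rightDividesʳ)

  infix 4 _≼_ _≅_

  _≼_ : V G → V G → Set (c ⊔ ℓ)
  _≼_ = _≤V_ G _⊢_

  _≅_ : V G → V G → Set (c ⊔ ℓ)
  u ≅ v = u ≼ v × v ≼ u

  _◂_ : Carrier → V G → V G
  _◂_ = _◃_ G

  _▸_ : V G → Carrier → V G
  _▸_ = _▹_ G

  private
    variable
      u u′ v v′ w : V G
      f g h : Carrier → Carrier

  ≼-isPreorder : IsPreorder _≅_ _≼_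
  ≼-isPreorder = record
    { isEquivalence = record
      { refl  = ≤V-refl , ≤V-refl
      ; sym   = swap
      ; trans = λ (u≼v , v≼u) (v≼w , w≼v) → ≤V-trans u≼v v≼w , ≤V-trans w≼v v≼u
      }
    ; reflexive = proj₁
    ; trans     = ≤V-trans
    }

  ≼-preorder : Preorder c (c ⊔ ℓ) (c ⊔ ℓ)
  ≼-preorder = record { isPreorder = ≼-isPreorder }

  ≅-setoid : Setoid c (c ⊔ ℓ)
  ≅-setoid = Preorder.Eq.setoid ≼-preorder

  open Setoid ≅-setoid using () renaming (sym to ≅-sym; trans to ≅-trans)

  module ≼-Reasoning = PreorderReasoning ≼-preorder
  module ≅-Reasoning = SetoidReasoning ≅-setoid

  infixr 5 _⨾_
  _⨾_ : u ≼ v → v ≼ w → u ≼ w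
  _⨾_ = ≤V-trans

  ≼-reflexive : u ≡.≡ v → u ≼ v
  ≼-reflexive ≡.refl = ≤V-refl

  ∧-mono : u ≼ u′ → v ≼ v′ → u ∧ v ≼ u′ ∧ v′
  ∧-mono u≼u′ v≼v′ = ∧-great (∧-lowerˡ ⨾ u≼u′) (∧-lowerʳ ⨾ v≼v′)

  ∨-mono : u ≼ u′ → v ≼ v′ → u ∨ v ≼ u′ ∨ v′
  ∨-mono u≼u′ v≼v′ = ∨-least (u≼u′ ⨾ ∨-upperˡ) (v≼v′ ⨾ ∨-upperʳ)

  ∧-cong : u ≅ u′ → v ≅ v′ → u ∧ v ≅ u′ ∧ v′
  ∧-cong (u≼u′ , u′≼u) (v≼v′ , v′≼v) = ∧-mono u≼u′ v≼v′ , ∧-mono u′≼u v′≼v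

  ∨-cong : u ≅ u′ → v ≅ v′ → u ∨ v ≅ u′ ∨ v′
  ∨-cong (u≼u′ , u′≼u) (v≼v′ , v′≼v) = ∨-mono u≼u′ v≼v′ , ∨-mono u′≼u v′≼v

  ∧-comm : u ∧ v ≼ v ∧ u
  ∧-comm = ∧-great ∧-lowerʳ ∧-lowerˡ

  ∨-comm : u ∨ v ≼ v ∨ u
  ∨-comm = ∨-least ∨-upperʳ ∨-upperˡ

  ∧-distribʳ-∨ : (u ∨ v) ∧ w ≼ (u ∧ w) ∨ (v ∧ w)
  ∧-distribʳ-∨ = ∧-comm ⨾ distrib ⨾ ∨-mono ∧-comm ∧-comm

  ∨-distribˡ-∧ : (u ∨ v) ∧ (u ∨ w) ≼ u ∨ (v ∧ w)
  ∨-distribˡ-∧ = distrib ⨾ ∨-least (∧-lowerʳ ⨾ ∨-upperˡ)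
    (∧-distribʳ-∨ ⨾ ∨-least (∧-lowerˡ ⨾ ∨-upperˡ) ∨-upperʳ)

  ∨-distribʳ-∧ : (v ∨ u) ∧ (w ∨ u) ≼ (v ∧ w) ∨ u
  ∨-distribʳ-∧ = ∧-mono ∨-comm ∨-comm ⨾ ∨-distribˡ-∧ ⨾ ∨-comm

  mapV : (Carrier → Carrier) → V G → V G
  mapV f (gen a) = gen (f a)
  mapV f (u ∧ v) = mapV f u ∧ mapV f v
  mapV f (u ∨ v) = mapV f u ∨ mapV f v

  mapV-∘ : ∀ w → mapV f (mapV g w) ≡.≡ mapV (f ∘ g) w
  mapV-∘ (gen a) = ≡.refl
  mapV-∘ (u ∧ v) = ≡.cong₂ _∧_ (mapV-∘ u) (mapV-∘ v)
  mapV-∘ (u ∨ v) = ≡.cong₂ _∨_ (mapV-∘ u) (mapV-∘ v)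

  mapV-id : ∀ w → mapV (λ a → a) w ≡.≡ w
  mapV-id (gen a) = ≡.refl
  mapV-id (u ∧ v) = ≡.cong₂ _∧_ (mapV-id u) (mapV-id v)
  mapV-id (u ∨ v) = ≡.cong₂ _∨_ (mapV-id u) (mapV-id v)

  ◂-as-mapV : ∀ x w → x ◂ w ≡.≡ mapV (x ∙_) w
  ◂-as-mapV x (gen a) = ≡.refl
  ◂-as-mapV x (u ∧ v) = ≡.cong₂ _∧_ (◂-as-mapV x u) (◂-as-mapV x v)
  ◂-as-mapV x (u ∨ v) = ≡.cong₂ _∨_ (◂-as-mapV x u) (◂-as-mapV x v)

  ▸-as-mapV : ∀ y w → w ▸ y ≡.≡ mapV (_∙ y) w
  ▸-as-mapV y (gen a) = ≡.refl
  ▸-as-mapV y (u ∧ v) = ≡.cong₂ _∧_ (▸-as-mapV y u) (▸-as-mapV y v)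
  ▸-as-mapV y (u ∨ v) = ≡.cong₂ _∨_ (▸-as-mapV y u) (▸-as-mapV y v)

  mapV-⋀′ : ∀ a l → mapV f (⋀′ a l) ≡.≡ ⋀′ (f a) (map f l)
  mapV-⋀′ a []      = ≡.refl
  mapV-⋀′ a (b ∷ l) = ≡.cong (gen _ ∧_) (mapV-⋀′ b l)

  mapV-⋁′ : ∀ a l → mapV f (⋁′ a l) ≡.≡ ⋁′ (f a) (map f l)
  mapV-⋁′ a []      = ≡.refl
  mapV-⋁′ a (b ∷ l) = ≡.cong (gen _ ∨_) (mapV-⋁′ b l)

  mapV-≤ : (∀ a → f a ≤ g a) → ∀ w → mapV f w ≼ mapV g w
  mapV-≤ f≤g (gen a) = rel (R3 (f≤g a))
  mapV-≤ f≤g (u ∧ v) = ∧-mono (mapV-≤ f≤g u) (mapV-≤ f≤g v)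
  mapV-≤ f≤g (u ∨ v) = ∨-mono (mapV-≤ f≤g u) (mapV-≤ f≤g v)

  mapV-cong : (∀ a → f a ≈ g a) → ∀ w → mapV f w ≅ mapV g w
  mapV-cong f≈g w =
    mapV-≤ (≤-reflexive ∘ f≈g) w ,
    mapV-≤ (≤-reflexive ∘ sym ∘ f≈g) w

  mapV-fuse : (∀ a → f (g a) ≈ h a) → ∀ w → mapV f (mapV g w) ≅ mapV h w
  mapV-fuse {f = f} {g = g} fg≈h w = begin
    mapV f (mapV g w) ≡⟨ mapV-∘ w ⟩
    mapV (f ∘ g) w    ≈⟨ mapV-cong fg≈h w ⟩
    mapV _ w          ∎
    where open ≅-Reasoning

  translate : Carrier → Carrier → V G → V G
  translate x y = mapV (λ a → (x ∙ a) ∙ y)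

  translate-cong : ∀ {x x′ y y′} → x ≈ x′ → y ≈ y′ → ∀ w → translate x y w ≅ translate x′ y′ w
  translate-cong x≈x′ y≈y′ = mapV-cong (λ a → ∙-cong (∙-congʳ x≈x′) y≈y′)

  translate-ε : ∀ w → translate ε ε w ≅ w
  translate-ε w = begin
    translate ε ε w  ≈⟨ mapV-cong (λ a → trans (identityʳ _) (identityˡ a)) w ⟩
    mapV (λ a → a) w ≡⟨ mapV-id w ⟩
    w                ∎
    where open ≅-Reasoning

  ◂-translate : ∀ z x y w → z ◂ translate x y w ≅ translate (z ∙ x) y w
  ◂-translate z x y w = begin
    z ◂ translate x y w             ≡⟨ ◂-as-mapV z (translate x y w) ⟩
    mapV (z ∙_) (translate x y w)   ≈⟨ mapV-fuse (λ a → trans (sym (assoc z _ y)) (∙-congʳ (sym (assoc z x a)))) w ⟩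
    translate (z ∙ x) y w           ∎
    where open ≅-Reasoning

  ▸-translate : ∀ z x y w → translate x y w ▸ z ≅ translate x (y ∙ z) w
  ▸-translate z x y w = begin
    translate x y w ▸ z             ≡⟨ ▸-as-mapV z (translate x y w) ⟩
    mapV (_∙ z) (translate x y w)   ≈⟨ mapV-fuse (λ a → assoc (x ∙ a) y z) w ⟩
    translate x (y ∙ z) w           ∎
    where open ≅-Reasoning

  translate-◂ : ∀ x y z w → translate x y (z ◂ w) ≅ translate (x ∙ z) y w
  translate-◂ x y z w = begin
    translate x y (z ◂ w)           ≡⟨ ≡.cong (translate x y) (◂-as-mapV z w) ⟩
    translate x y (mapV (z ∙_) w)   ≈⟨ mapV-fuse (λ a → ∙-congʳ (sym (assoc x z a))) w ⟩
    translate (x ∙ z) y w           ∎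
    where open ≅-Reasoning

  translate-▸ : ∀ x y z w → translate x y (w ▸ z) ≅ translate x (z ∙ y) w
  translate-▸ x y z w = begin
    translate x y (w ▸ z)           ≡⟨ ≡.cong (translate x y) (▸-as-mapV z w) ⟩
    translate x y (mapV (_∙ z) w)   ≈⟨ mapV-fuse (λ a → trans (∙-congʳ (sym (assoc x a z))) (assoc (x ∙ a) z y)) w ⟩
    translate x (z ∙ y) w           ∎
    where open ≅-Reasoning

  translate-⊢ : ∀ x y {A B} → A ⊢ B → _·_·_ G x A y ⊢ _·_·_ G x B y
  translate-⊢ x y {a ∷ l} {b ∷ m} A⊢B =
    R4 {x = x ⁻¹} {y = y ⁻¹} (R1 (untranslate (a ∷ l)) (untranslate (b ∷ m)) A⊢B)
    where
      untranslated : ∀ w → (x ⁻¹ ∙ ((x ∙ w) ∙ y)) ∙ y ⁻¹ ≈ w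
      untranslated w = trans (∙-congʳ (trans (∙-congˡ (assoc x w y)) (\\-leftDividesʳ x (w ∙ y))))
                             (//-rightDividesʳ y w)
      untranslate : ∀ {z} l → Any.Any (z ≈_) l →
                    Any.Any (z ≈_) (map (λ w → (x ⁻¹ ∙ w) ∙ y ⁻¹) (map (λ w → (x ∙ w) ∙ y) l))
      untranslate _ = Any.map⁺ ∘ Any.map⁺ ∘ Any.map (λ z≈w → trans z≈w (sym (untranslated _)))

  translate-mono : ∀ x y → u ≼ v → translate x y u ≼ translate x y v
  translate-mono x y ≤V-refl          = ≤V-refl
  translate-mono x y (≤V-trans p q)   = translate-mono x y p ⨾ translate-mono x y q
  translate-mono x y ∧-lowerˡ         = ∧-lowerˡ
  translate-mono x y ∧-lowerʳ         = ∧-lowerʳ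
  translate-mono x y (∧-great p q)    = ∧-great (translate-mono x y p) (translate-mono x y q)
  translate-mono x y ∨-upperˡ         = ∨-upperˡ
  translate-mono x y ∨-upperʳ         = ∨-upperʳ
  translate-mono x y (∨-least p q)    = ∨-least (translate-mono x y p) (translate-mono x y q)
  translate-mono x y distrib          = distrib
  translate-mono x y (rel {a ∷ l} {b ∷ m} A⊢B) =
    ≼-reflexive (mapV-⋀′ a l) ⨾ rel (translate-⊢ x y A⊢B) ⨾ ≼-reflexive (≡.sym (mapV-⋁′ b m))

  ◂-mono : ∀ x → u ≼ v → x ◂ u ≼ x ◂ v
  ◂-mono {u} {v} x u≼v = begin
    x ◂ u           ≡⟨ ◂-as-mapV x u ⟩
    mapV (x ∙_) u   ≈⟨ mapV-cong (λ a → sym (identityʳ (x ∙ a))) u ⟩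
    translate x ε u ≲⟨ translate-mono x ε u≼v ⟩
    translate x ε v ≈⟨ mapV-cong (λ a → sym (identityʳ (x ∙ a))) v ⟨
    mapV (x ∙_) v   ≡⟨ ◂-as-mapV x v ⟨
    x ◂ v           ∎
    where open ≼-Reasoning

  ▸-mono : ∀ y → u ≼ v → u ▸ y ≼ v ▸ y
  ▸-mono {u} {v} y u≼v = begin
    u ▸ y           ≡⟨ ▸-as-mapV y u ⟩
    mapV (_∙ y) u   ≈⟨ mapV-cong (λ a → ∙-congʳ (sym (identityˡ a))) u ⟩
    translate ε y u ≲⟨ translate-mono ε y u≼v ⟩
    translate ε y v ≈⟨ mapV-cong (λ a → ∙-congʳ (sym (identityˡ a))) v ⟨
    mapV (_∙ y) v   ≡⟨ ▸-as-mapV y v ⟨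
    v ▸ y           ∎
    where open ≼-Reasoning

  ◂-cong : ∀ x → u ≅ v → x ◂ u ≅ x ◂ v
  ◂-cong x (u≼v , v≼u) = ◂-mono x u≼v , ◂-mono x v≼u

  ▸-cong : ∀ y → u ≅ v → u ▸ y ≅ v ▸ y
  ▸-cong y (u≼v , v≼u) = ▸-mono y u≼v , ▸-mono y v≼u

  R5ᵛ-gen : ∀ a B s t → (s ◂ gen a) ∧ (B ▸ t) ≼ (s ◂ B) ∨ (gen a ▸ t)
  R5ᵛ-gen a (gen b)   s t = rel (R5 a b s t)
  R5ᵛ-gen a (B₁ ∧ B₂) s t =
    ∧-great (∧-mono ≤V-refl ∧-lowerˡ ⨾ R5ᵛ-gen a B₁ s t) (∧-mono ≤V-refl ∧-lowerʳ ⨾ R5ᵛ-gen a B₂ s t)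
    ⨾ ∨-distribʳ-∧
  R5ᵛ-gen a (B₁ ∨ B₂) s t =
    distrib ⨾ ∨-mono (R5ᵛ-gen a B₁ s t) (R5ᵛ-gen a B₂ s t)
    ⨾ ∨-least (∨-mono ∨-upperˡ ≤V-refl) (∨-mono ∨-upperʳ ≤V-refl)

  R5ᵛ : ∀ A B s t → (s ◂ A) ∧ (B ▸ t) ≼ (s ◂ B) ∨ (A ▸ t)
  R5ᵛ (gen a)   B s t = R5ᵛ-gen a B s t
  R5ᵛ (A₁ ∧ A₂) B s t =
    ∧-great (∧-mono ∧-lowerˡ ≤V-refl ⨾ R5ᵛ A₁ B s t) (∧-mono ∧-lowerʳ ≤V-refl ⨾ R5ᵛ A₂ B s t)
    ⨾ ∨-distribˡ-∧
  R5ᵛ (A₁ ∨ A₂) B s t =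
    ∧-distribʳ-∨ ⨾ ∨-mono (R5ᵛ A₁ B s t) (R5ᵛ A₂ B s t)
    ⨾ ∨-least (∨-mono ≤V-refl ∨-upperˡ) (∨-mono ≤V-refl ∨-upperʳ)

  Constraints : Set c
  Constraints = List (V G × V G)

  infix 4 _≼[_]_

  -- Each pair (p , q) is a hypothesis p ≤ q, used as a cut: u ≤ v follows from u ≤ v ∨ p and
  -- u ∧ q ≤ v.

  _≼[_]_ : V G → Constraints → V G → Set (c ⊔ ℓ)
  u ≼[ [] ]          v = u ≼ v
  u ≼[ (p , q) ∷ S ] v = u ≼[ S ] v ∨ p × u ∧ q ≼[ S ] v

  ≼⇒≼[] : ∀ S → u ≼ v → u ≼[ S ] v
  ≼⇒≼[] []            u≼v = u≼v
  ≼⇒≼[] ((p , q) ∷ S) u≼v = ≼⇒≼[] S (u≼v ⨾ ∨-upperˡ) , ≼⇒≼[] S (∧-lowerˡ ⨾ u≼v)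

  ≼[]-resp-≼ : ∀ S → u′ ≼ u → v ≼ v′ → u ≼[ S ] v → u′ ≼[ S ] v′
  ≼[]-resp-≼ []            u′≼u v≼v′ u≼v = u′≼u ⨾ u≼v ⨾ v≼v′
  ≼[]-resp-≼ ((p , q) ∷ S) u′≼u v≼v′ (u≼v∨p , u∧q≼v) =
    ≼[]-resp-≼ S u′≼u (∨-mono v≼v′ ≤V-refl) u≼v∨p , ≼[]-resp-≼ S (∧-mono u′≼u ≤V-refl) v≼v′ u∧q≼v

  ≼[]-∨ʳ : ∀ S w → u ≼[ S ] v → u ∨ w ≼[ S ] v ∨ w
  ≼[]-∨ʳ []            w u≼v = ∨-mono u≼v ≤V-refl
  ≼[]-∨ʳ ((p , q) ∷ S) w (u≼v∨p , u∧q≼v) =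
    ≼[]-resp-≼ S ≤V-refl (∨-least (∨-mono ∨-upperˡ ≤V-refl) (∨-upperʳ ⨾ ∨-upperˡ)) (≼[]-∨ʳ S w u≼v∨p) ,
    ≼[]-resp-≼ S (∧-distribʳ-∨ ⨾ ∨-mono ≤V-refl ∧-lowerˡ) ≤V-refl (≼[]-∨ʳ S w u∧q≼v)

  ≼[]-∧ʳ : ∀ S w → u ≼[ S ] v → u ∧ w ≼[ S ] v ∧ w
  ≼[]-∧ʳ []            w u≼v = ∧-mono u≼v ≤V-refl
  ≼[]-∧ʳ ((p , q) ∷ S) w (u≼v∨p , u∧q≼v) =
    ≼[]-resp-≼ S ≤V-refl (∧-distribʳ-∨ ⨾ ∨-mono ≤V-refl ∧-lowerˡ) (≼[]-∧ʳ S w u≼v∨p) ,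
    ≼[]-resp-≼ S (∧-great (∧-mono ∧-lowerˡ ≤V-refl) (∧-lowerˡ ⨾ ∧-lowerʳ)) ≤V-refl (≼[]-∧ʳ S w u∧q≼v)

  ≼[]-trans : ∀ S → u ≼[ S ] v → v ≼[ S ] w → u ≼[ S ] w
  ≼[]-trans []            u≼v v≼w = u≼v ⨾ v≼w
  ≼[]-trans ((p , q) ∷ S) (u≼v∨p , u∧q≼v) (v≼w∨p , v∧q≼w) =
    ≼[]-trans S u≼v∨p (≼[]-resp-≼ S ≤V-refl (∨-least ≤V-refl ∨-upperʳ) (≼[]-∨ʳ S p v≼w∨p)) ,
    ≼[]-trans S (≼[]-resp-≼ S (∧-great ≤V-refl ∧-lowerʳ) ≤V-refl (≼[]-∧ʳ S q u∧q≼v)) v∧q≼w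

  ≼[]-++ˡ : ∀ T S → u ≼[ S ] v → u ≼[ T ++ S ] v
  ≼[]-++ˡ []            S u≼v = u≼v
  ≼[]-++ˡ ((p , q) ∷ T) S u≼v =
    ≼[]-resp-≼ (T ++ S) ≤V-refl ∨-upperˡ (≼[]-++ˡ T S u≼v) ,
    ≼[]-resp-≼ (T ++ S) ∧-lowerˡ ≤V-refl (≼[]-++ˡ T S u≼v)

  ≼[]-++ʳ : ∀ S T → u ≼[ S ] v → u ≼[ S ++ T ] v
  ≼[]-++ʳ []            T u≼v               = ≼⇒≼[] T u≼v
  ≼[]-++ʳ ((p , q) ∷ S) T (u≼v∨p , u∧q≼v) = ≼[]-++ʳ S T u≼v∨p , ≼[]-++ʳ S T u∧q≼v

  ≼[]-map : (φ : V G → V G) → (∀ {u v} → u ≼ v → φ u ≼ φ v) →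
            (∀ {u v} → φ (u ∨ v) ≼ φ u ∨ φ v) → (∀ {u v} → φ u ∧ φ v ≼ φ (u ∧ v)) →
            ∀ S → u ≼[ S ] v → φ u ≼[ map (Product.map φ φ) S ] φ v
  ≼[]-map φ φ-mono φ-∨ φ-∧ []            u≼v = φ-mono u≼v
  ≼[]-map φ φ-mono φ-∨ φ-∧ ((p , q) ∷ S) (u≼v∨p , u∧q≼v) =
    ≼[]-resp-≼ S′ ≤V-refl φ-∨ (≼[]-map φ φ-mono φ-∨ φ-∧ S u≼v∨p) ,
    ≼[]-resp-≼ S′ φ-∧ ≤V-refl (≼[]-map φ φ-mono φ-∨ φ-∧ S u∧q≼v)
    where S′ = map (Product.map φ φ) S

  cut-orthogonal : ∀ {p q p′ q′} → p ∧ p′ ≼ q ∨ q′ →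
                   u ≼ v ∨ p → u ≼ v ∨ p′ → u ∧ q ≼ v → u ∧ q′ ≼ v → u ≼ v
  cut-orthogonal {u} {v} {p} {q} {p′} {q′} orthogonal u≼v∨p u≼v∨p′ u∧q≼v u∧q′≼v = begin
    u                                ≲⟨ ∧-great ≤V-refl (∧-great u≼v∨p u≼v∨p′) ⟩
    u ∧ ((v ∨ p) ∧ (v ∨ p′))         ≲⟨ ∧-mono ≤V-refl (∨-distribˡ-∧ ⨾ ∨-mono ≤V-refl orthogonal) ⟩
    u ∧ (v ∨ (q ∨ q′))               ≲⟨ distrib ⨾ ∨-mono ≤V-refl distrib ⟩
    (u ∧ v) ∨ ((u ∧ q) ∨ (u ∧ q′))   ≲⟨ ∨-least ∧-lowerʳ (∨-least u∧q≼v u∧q′≼v) ⟩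
    v                                ∎
    where open ≼-Reasoning

  module _ {p₁ p₂} {P₁ : V G × V G → Set p₁} {P₂ : V G × V G → Set p₂}
           (orthogonal : ∀ {p q p′ q′} → P₁ (p , q) → P₂ (p′ , q′) → p ∧ p′ ≼ q ∨ q′) where

    eliminate-orthogonal : ∀ S₁ S₂ → All P₁ S₁ → All P₂ S₂ → u ≼[ S₁ ] v → u ≼[ S₂ ] v → u ≼ v
    eliminate-orthogonal []      _  _ _ u≼v _   = u≼v
    eliminate-orthogonal (_ ∷ _) [] _ _ _   u≼v = u≼v
    eliminate-orthogonal S₁@(_ ∷ T₁) S₂@(_ ∷ T₂) P₁S₁@(pq ∷ P₁T₁) P₂S₂@(p′q′ ∷ P₂T₂)
                         H@(H∨ , H∧) K@(K∨ , K∧) =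
      cut-orthogonal (orthogonal pq p′q′)
        (eliminate-orthogonal T₁ S₂ P₁T₁ P₂S₂ H∨ (≼[]-resp-≼ S₂ ≤V-refl ∨-upperˡ K))
        (eliminate-orthogonal S₁ T₂ P₁S₁ P₂T₂ (≼[]-resp-≼ S₁ ≤V-refl ∨-upperˡ H) K∨)
        (eliminate-orthogonal T₁ S₂ P₁T₁ P₂S₂ H∧ (≼[]-resp-≼ S₂ ∧-lowerˡ ≤V-refl K))
        (eliminate-orthogonal S₁ T₂ P₁S₁ P₂T₂ (≼[]-resp-≼ S₁ ∧-lowerˡ ≤V-refl H) K∧)

  IsTranslatedAxiom : V G → V G → V G × V G → Set (c ⊔ ℓ)
  IsTranslatedAxiom a b (p , q) = ∃₂ λ x y → p ≅ translate x y b × q ≅ translate x y a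

  axiom-isTranslatedAxiom : ∀ a b → IsTranslatedAxiom a b (b , a)
  axiom-isTranslatedAxiom a b = ε , ε , ≅-sym (translate-ε b) , ≅-sym (translate-ε a)

  ◂-isTranslatedAxiom : ∀ {a b} z pq → IsTranslatedAxiom a b pq →
                        IsTranslatedAxiom a b (Product.map (z ◂_) (z ◂_) pq)
  ◂-isTranslatedAxiom {a} {b} z _ (x , y , p≅ , q≅) =
    z ∙ x , y , ≅-trans (◂-cong z p≅) (◂-translate z x y b) , ≅-trans (◂-cong z q≅) (◂-translate z x y a)

  ▸-isTranslatedAxiom : ∀ {a b} z pq → IsTranslatedAxiom a b pq →
                        IsTranslatedAxiom a b (Product.map (_▸ z) (_▸ z) pq)
  ▸-isTranslatedAxiom {a} {b} z _ (x , y , p≅ , q≅) =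
    x , y ∙ z , ≅-trans (▸-cong z p≅) (▸-translate z x y b) , ≅-trans (▸-cong z q≅) (▸-translate z x y a)

  translatedAxioms-orthogonal : ∀ {a b p q p′ q′} →
    IsTranslatedAxiom a b (p , q) → IsTranslatedAxiom b a (p′ , q′) → p ∧ p′ ≼ q ∨ q′
  translatedAxioms-orthogonal {a} {b} {p} {q} {p′} {q′} (x , y , p≅ , q≅) (x′ , y′ , p′≅ , q′≅) = begin
    p ∧ p′                                          ≈⟨ ∧-cong p≅ p′≅ ⟩
    translate x y b ∧ translate x′ y′ a             ≈⟨ ∧-cong (shiftʳ b) (shiftˡ a) ⟨
    translate x y′ (b ▸ t) ∧ translate x y′ (s ◂ a) ≲⟨ translate-mono x y′ (∧-comm ⨾ R5ᵛ a b s t) ⟩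
    translate x y′ (s ◂ b) ∨ translate x y′ (a ▸ t) ≈⟨ ∨-cong (shiftˡ b) (shiftʳ a) ⟩
    translate x′ y′ b ∨ translate x y a             ≈⟨ ∨-cong q′≅ q≅ ⟨
    q′ ∨ q                                          ≲⟨ ∨-comm ⟩
    q ∨ q′                                          ∎
    where
      open ≼-Reasoning
      s = x \\ x′
      t = y // y′
      shiftˡ : ∀ w → translate x y′ (s ◂ w) ≅ translate x′ y′ w
      shiftˡ w = ≅-trans (translate-◂ x y′ s w) (translate-cong (\\-leftDividesˡ x x′) refl w)
      shiftʳ : ∀ w → translate x y′ (w ▸ t) ≅ translate x y w
      shiftʳ w = ≅-trans (translate-▸ x y′ t w) (translate-cong refl (//-rightDividesˡ y′ y) w)

  ≤[]⇒≼[] : ∀ {a b} → ≤[_,_] G _⊢_ a b u v →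
            Σ[ S ∈ Constraints ] All (IsTranslatedAxiom a b) S × u ≼[ S ] v
  ≤[]⇒≼[] (base u≼v) = [] , [] , u≼v
  ≤[]⇒≼[] (trans′ d e) =
    let (S₁ , A₁ , u≼v) = ≤[]⇒≼[] d
        (S₂ , A₂ , v≼w) = ≤[]⇒≼[] e
    in S₁ ++ S₂ , All.++⁺ A₁ A₂ , ≼[]-trans (S₁ ++ S₂) (≼[]-++ʳ S₁ S₂ u≼v) (≼[]-++ˡ S₁ S₂ v≼w)
  ≤[]⇒≼[] (∧-compatˡ w d) =
    let (S , A , u≼v) = ≤[]⇒≼[] d in S , A , ≼[]-resp-≼ S ∧-comm ∧-comm (≼[]-∧ʳ S w u≼v)
  ≤[]⇒≼[] (∧-compatʳ w d) =
    let (S , A , u≼v) = ≤[]⇒≼[] d in S , A , ≼[]-∧ʳ S w u≼v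
  ≤[]⇒≼[] (∨-compatˡ w d) =
    let (S , A , u≼v) = ≤[]⇒≼[] d in S , A , ≼[]-resp-≼ S ∨-comm ∨-comm (≼[]-∨ʳ S w u≼v)
  ≤[]⇒≼[] (∨-compatʳ w d) =
    let (S , A , u≼v) = ≤[]⇒≼[] d in S , A , ≼[]-∨ʳ S w u≼v
  ≤[]⇒≼[] (left x d) =
    let (S , A , u≼v) = ≤[]⇒≼[] d
    in _ , All.map⁺ (All.map (◂-isTranslatedAxiom x _) A) ,
       ≼[]-map (x ◂_) (◂-mono x) ≤V-refl ≤V-refl S u≼v
  ≤[]⇒≼[] (right y d) =
    let (S , A , u≼v) = ≤[]⇒≼[] d
    in _ , All.map⁺ (All.map (▸-isTranslatedAxiom y _) A) ,
       ≼[]-map (_▸ y) (▸-mono y) ≤V-refl ≤V-refl S u≼v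
  ≤[]⇒≼[] {a = a} {b} ax = (b , a) ∷ [] , axiom-isTranslatedAxiom a b ∷ [] , ∨-upperʳ , ∧-lowerʳ

proposition7p3 : ∀ {c ℓ₁ ℓ₂ ℓ} (G : PreorderedGroup c ℓ₁ ℓ₂)
    (_⊢_ : Fin⁺ G → Fin⁺ G → Set ℓ) → IsRegularEntailment G _⊢_ →
    (a b u v : V G) →
    ≤[_,_] G _⊢_ a b u v → ≤[_,_] G _⊢_ b a u v → _≤V_ G _⊢_ u v
proposition7p3 G _⊢_ regular a b u v d₁ d₂ =
  let (S₁ , translated₁ , u≼[S₁]v) = ≤[]⇒≼[] d₁
      (S₂ , translated₂ , u≼[S₂]v) = ≤[]⇒≼[] d₂
  in eliminate-orthogonal translatedAxioms-orthogonal S₁ S₂ translated₁ translated₂ u≼[S₁]v u≼[S₂]v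
  where open Theory G _⊢_ regular
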